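{- If $G$ is a connected $\gamma_{tR}$-ER-critical graph, then $G$ is a tree.
   Context: All graphs are finite and simple. A total Roman dominating function (TRD-function) on a graph $G$ with no isolated vertices is a function $f:V(G)\to\{0,1,2\}$ such that every vertex $v$ with $f(v)=0$ is adjacent to some $u$ with $f(u)=2$, and the subgraph induced by $\{w:f(w)>0\}$ has no isolated vertices; its weight is $\sum_v f(v)$ and $\gamma_{tR}(G)$ is the minimum weight. For an edge $e$ incident with a vertex of degree $1$, define $\gamma_{tR}(G-e)=\infty$. A graph $G$ with no isolated vertices is $\gamma_{tR}$-ER-critical if $\gamma_{tR}(G-e)>\gamma_{tR}(G)$ for every edge $e\in E(G)$. -}

module Defs where

open import Data.Nat using (ℕ; zero; suc; _+_; _≤_; _<_)
open import Data.Bool using (Bool; true; false; _∧_; _∨_; not; if_then_else_)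
open import Data.Fin using (Fin; zero; suc; inject₁; fromℕ; _≟_)
open import Data.List using (List; map; allFin)
open import Data.Nat.ListAction using (sum)
open import Data.Product using (Σ; ∃; ∃-syntax; _×_; _,_)
open import Data.Sum using (_⊎_)
open import Relation.Nullary using (¬_)
open import Relation.Nullary.Decidable using (⌊_⌋)
open import Relation.Binary.PropositionalEquality using (_≡_; _≢_)
open import Relation.Binary.Construct.Closure.ReflexiveTransitive using (Star)
open import Function.Definitions using (Injective)

record Graph (n : ℕ) : Set where
  field
    adj   : Fin n → Fin n → Bool
    sym   : ∀ u v → adj u v ≡ adj v u
    irrefl : ∀ v → adj v v ≡ false

open Graph public

Adj : ∀ {n} → Graph n → Fin n → Fin n → Set
Adj G u v = adj G u v ≡ true

deg : ∀ {n} → Graph n → Fin n → ℕ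
deg {n} G v = sum (map (λ w → if adj G v w then 1 else 0) (allFin n))

NoIsolated : ∀ {n} → Graph n → Set
NoIsolated {n} G = ∀ (v : Fin n) → ∃[ u ] Adj G v u

isPair : ∀ {n} → Fin n → Fin n → Fin n → Fin n → Bool
isPair u v x y = (⌊ x ≟ u ⌋ ∧ ⌊ y ≟ v ⌋) ∨ (⌊ x ≟ v ⌋ ∧ ⌊ y ≟ u ⌋)

deleteEdge : ∀ {n} → Graph n → Fin n → Fin n → Graph n
deleteEdge G u v = record
  { adj = λ x y → adj G x y ∧ not (isPair u v x y)
  ; sym = symm
  ; irrefl = irr
  }
  where
  open import Relation.Binary.PropositionalEquality using (refl; cong₂; trans)
  open import Data.Bool.Properties using (∨-comm; ∧-comm)
  swap : ∀ x y → isPair u v x y ≡ isPair u v y x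
  swap x y = trans (∨-comm (⌊ x ≟ u ⌋ ∧ ⌊ y ≟ v ⌋) (⌊ x ≟ v ⌋ ∧ ⌊ y ≟ u ⌋)) (cong₂ _∨_ (∧-comm ⌊ x ≟ v ⌋ ⌊ y ≟ u ⌋) (∧-comm ⌊ x ≟ u ⌋ ⌊ y ≟ v ⌋))
  symm : ∀ x y → (adj G x y ∧ not (isPair u v x y)) ≡ (adj G y x ∧ not (isPair u v y x))
  symm x y = cong₂ (λ a b → a ∧ not b) (Graph.sym G x y) (swap x y)
  irr : ∀ x → (adj G x x ∧ not (isPair u v x x)) ≡ false
  irr x = cong₂ (λ a b → a ∧ b) (Graph.irrefl G x) refl

record IsTRDF {n} (G : Graph n) (f : Fin n → ℕ) : Set where
  field
    range : ∀ v → f v ≤ 2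
    roman : ∀ v → f v ≡ 0 → ∃[ u ] (Adj G v u × f u ≡ 2)
    total : ∀ v → 0 < f v → ∃[ u ] (Adj G v u × 0 < f u)

weight : ∀ {n} → (Fin n → ℕ) → ℕ
weight {n} f = sum (map f (allFin n))

IsγtR : ∀ {n} → Graph n → ℕ → Set
IsγtR {n} G k =
  (∃[ f ] (IsTRDF G f × weight f ≡ k)) ×
  (∀ (f : Fin n → ℕ) → IsTRDF G f → k ≤ weight f)

-- γ_tR-ER-critical: no isolated vertices, and for every edge e = uv,
-- γ_tR(G - e) > γ_tR(G), where γ_tR(G - e) = ∞ if u or v has degree 1.
ERCritical : ∀ {n} → Graph n → Set
ERCritical {n} G =
  NoIsolated G ×
  (∀ (u v : Fin n) → Adj G u v →
     deg G u ≡ 1 ⊎ deg G v ≡ 1 ⊎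
     (∀ k k' → IsγtR G k → IsγtR (deleteEdge G u v) k' → k < k'))

Connected : ∀ {n} → Graph n → Set
Connected {n} G = ∀ (u v : Fin n) → Star (Adj G) u v

-- a cycle of length m+3: injective c with c i ~ c (i+1) and c last ~ c 0
HasCycle : ∀ {n} → Graph n → Set
HasCycle {n} G =
  ∃[ m ] ∃[ c ] (Injective _≡_ _≡_ c ×
    (∀ (i : Fin (suc (suc m))) → Adj G (c (inject₁ i)) (c (suc i))) ×
    Adj G (c (fromℕ (suc (suc m)))) (c zero))

IsTree : ∀ {n} → Graph n → Set
IsTree G = Connected G × ¬ HasCycle G

{-# OPTIONS --safe #-}
module Submission where

-- Let f be a TRD-function of minimum weight. If an edge uv with both ends of
-- degree at least 2 could be deleted with f remaining a TRD-function of G − uv,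
-- then γtR(G − uv) ≤ γtR(G), against criticality; so one end of uv relies on
-- it, i.e. uv is its only edge to a vertex of value 2 (if its value is 0) or
-- to a positive vertex (if its value is positive). A vertex of value 0 relies
-- on at most one edge and nothing relies on it, so every vertex of a cycle is
-- positive; but then the relying end of a cycle edge has its other cycle
-- neighbour as a second positive neighbour.

open import Data.Nat using (ℕ)
open import Defs

open import Data.Nat using (zero; suc; _+_; _≤_; _<_; _<?_; s≤s; z≤n)
  renaming (_≟_ to _≟ℕ_)
open import Data.Nat.Properties
  using ( module ≤-Reasoning; ≤-trans; ≤-refl; <-≤-trans; ≮⇒≥; <-irrefl
        ; +-monoʳ-≤; +-comm; m≤m+n; m≤n+m; m≢1+n+m)
open import Data.Nat.Induction using (<-rec)
open import Data.Nat.ListAction using (sum)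
open import Data.Bool using (true; false; _∧_; if_then_else_)
import Data.Bool.Properties as Bool
open import Data.Fin using (Fin; zero; suc; fromℕ; toℕ; _≟_)
open import Data.Fin.Properties using (any?; all?; toℕ-fromℕ; toℕ-inject₁)
open import Data.Fin.Relation.Unary.Top using (View; view; ‵fromℕ; ‵inj₁)
open import Data.List using (tabulate)
open import Data.List.Properties using (map-tabulate)
open import Data.Product using (∃-syntax; _×_; _,_; proj₁; proj₂)
open import Data.Sum using (_⊎_; inj₁; inj₂; swap)
open import Data.Empty using (⊥-elim)
open import Function using (_∘_)
open import Relation.Nullary using (¬_; Dec; yes; no; contradiction)
open import Relation.Nullary.Decidable
  using (⌊_⌋; _×-dec_; _⊎-dec_; _→-dec_; ¬?; decidable-stable)
open import Relation.Unary using (Decidable)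
open import Relation.Binary.PropositionalEquality
  using (_≡_; _≢_; refl; trans; cong; cong₂; subst; module ≡-Reasoning)
  renaming (sym to ≡-sym)

Least : (ℕ → Set) → Set
Least P = ∃[ k ] (P k × ∀ m → P m → k ≤ m)

¬¬-least : ∀ (P : ℕ → Set) j → P j → ¬ ¬ Least P
¬¬-least P = <-rec (λ j → P j → ¬ ¬ Least P) step
  where
  step : ∀ j → (∀ {i} → i < j → P i → ¬ ¬ Least P) → P j → ¬ ¬ Least P
  step j below pj ¬least = ¬least (j , pj , λ m pm → ≮⇒≥ λ m<j → below m<j pm ¬least)

lookup≤sum-tabulate : ∀ {m} (h : Fin m → ℕ) p → h p ≤ sum (tabulate h)
lookup≤sum-tabulate h zero = m≤m+n (h zero) _
lookup≤sum-tabulate h (suc p) =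
  ≤-trans (lookup≤sum-tabulate (h ∘ suc) p) (m≤n+m _ (h zero))

lookup+lookup≤sum-tabulate : ∀ {m} (h : Fin m → ℕ) {p q} → p ≢ q →
                             h p + h q ≤ sum (tabulate h)
lookup+lookup≤sum-tabulate h {zero} {zero} p≢q = ⊥-elim (p≢q refl)
lookup+lookup≤sum-tabulate h {zero} {suc q} _ =
  +-monoʳ-≤ (h zero) (lookup≤sum-tabulate (h ∘ suc) q)
lookup+lookup≤sum-tabulate h {suc p} {zero} _ =
  subst (_≤ sum (tabulate h)) (+-comm (h zero) (h (suc p)))
    (+-monoʳ-≤ (h zero) (lookup≤sum-tabulate (h ∘ suc) p))
lookup+lookup≤sum-tabulate h {suc p} {suc q} p≢q =
  ≤-trans (lookup+lookup≤sum-tabulate (h ∘ suc) (p≢q ∘ cong suc)) (m≤n+m _ (h zero))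

≟∧≟≡false : ∀ {n} {x u y v : Fin n} → ¬ (x ≡ u × y ≡ v) → (⌊ x ≟ u ⌋ ∧ ⌊ y ≟ v ⌋) ≡ false
≟∧≟≡false {x = x} {u} {y} {v} ¬eq with x ≟ u | y ≟ v
... | yes x≡u | yes y≡v = ⊥-elim (¬eq (x≡u , y≡v))
... | yes _   | no _    = refl
... | no _    | _       = refl

module _ {n} (G : Graph n) where

  Adj-sym : ∀ {u v} → Adj G u v → Adj G v u
  Adj-sym {u} {v} uv = trans (Graph.sym G v u) uv

  Adj⇒≢ : ∀ {u v} → Adj G u v → u ≢ v
  Adj⇒≢ {u} uu refl with trans (≡-sym uu) (Graph.irrefl G u)
  ... | ()

  Adj? : ∀ u v → Dec (Adj G u v)
  Adj? u v = adj G u v Bool.≟ true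

  2≤deg : ∀ {v p q} → Adj G v p → Adj G v q → p ≢ q → 2 ≤ deg G v
  2≤deg {v} {p} {q} vp vq p≢q = begin
    2                                ≡⟨ cong₂ _+_ (indicator-adj vp) (indicator-adj vq) ⟩
    indicator p + indicator q        ≤⟨ lookup+lookup≤sum-tabulate indicator p≢q ⟩
    sum (tabulate indicator)         ≡⟨ cong sum (map-tabulate (λ w → w) indicator) ⟨
    deg G v                          ∎
    where
    open ≤-Reasoning
    indicator : Fin n → ℕ
    indicator w = if adj G v w then 1 else 0
    indicator-adj : ∀ {w} → Adj G v w → 1 ≡ indicator w
    indicator-adj vw rewrite vw = refl

  Adj-deleteEdge : ∀ {u v x y} → Adj G x y → ¬ (x ≡ u × y ≡ v) → ¬ (x ≡ v × y ≡ u) →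
                   Adj (deleteEdge G u v) x y
  Adj-deleteEdge xy ¬uv ¬vu rewrite xy | ≟∧≟≡false ¬uv | ≟∧≟≡false ¬vu = refl

  UniqueNeighbour : (Fin n → Set) → Fin n → Fin n → Set
  UniqueNeighbour Q u v = ∀ y → Adj G u y → Q y → y ≡ v

  UniqueNeighbour? : ∀ {Q} → Decidable Q → ∀ u v → Dec (UniqueNeighbour Q u v)
  UniqueNeighbour? Q? u v = all? λ y → Adj? u y →-dec Q? y →-dec y ≟ v

  ¬unique⇒another : ∀ {Q} → Decidable Q → ∀ {u v} → ¬ UniqueNeighbour Q u v →
                    ∃[ y ] (Adj G u y × Q y × y ≢ v)
  ¬unique⇒another Q? {u} {v} ¬unique
    with any? (λ y → Adj? u y ×-dec Q? y ×-dec ¬? (y ≟ v))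
  ... | yes another = another
  ... | no none = ⊥-elim (¬unique λ y uy qy →
                    decidable-stable (y ≟ v) λ y≢v → none (y , uy , qy , y≢v))

  ∃neighbour-deleteEdge : ∀ {Q} → Decidable Q → ∀ {u v w} →
    (w ≡ u → ¬ UniqueNeighbour Q u v) → (w ≡ v → ¬ UniqueNeighbour Q v u) →
    ∃[ y ] (Adj G w y × Q y) → ∃[ y ] (Adj (deleteEdge G u v) w y × Q y)
  ∃neighbour-deleteEdge Q? {u} {v} {w} ¬uniqueᵤ ¬uniqueᵥ (y , wy , qy)
    with w ≟ u ×-dec y ≟ v | w ≟ v ×-dec y ≟ u
  ... | yes (refl , refl) | _ =
    let (y′ , uy′ , qy′ , y′≢v) = ¬unique⇒another Q? (¬uniqueᵤ refl)
    in y′ , Adj-deleteEdge uy′ (y′≢v ∘ proj₂) (Adj⇒≢ wy ∘ proj₁) , qy′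
  ... | _ | yes (refl , refl) =
    let (y′ , vy′ , qy′ , y′≢u) = ¬unique⇒another Q? (¬uniqueᵥ refl)
    in y′ , Adj-deleteEdge vy′ (Adj⇒≢ wy ∘ proj₁) (y′≢u ∘ proj₂) , qy′
  ... | no ¬uv | no ¬vu = y , Adj-deleteEdge wy ¬uv ¬vu , qy

module Reliance {n} (G : Graph n) (f : Fin n → ℕ) where

  Two Positive : Fin n → Set
  Two y = f y ≡ 2
  Positive y = 0 < f y

  ReliesOn : Fin n → Fin n → Set
  ReliesOn u v = (f u ≡ 0 × UniqueNeighbour G Two u v)
               ⊎ (Positive u × UniqueNeighbour G Positive u v)

  Needed : Fin n → Fin n → Set
  Needed u v = ReliesOn u v ⊎ ReliesOn v u

  ReliesOn? : ∀ u v → Dec (ReliesOn u v)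
  ReliesOn? u v = (f u ≟ℕ 0 ×-dec UniqueNeighbour? G (λ y → f y ≟ℕ 2) u v)
            ⊎-dec (0 <? f u ×-dec UniqueNeighbour? G (λ y → 0 <? f y) u v)

  Needed? : ∀ u v → Dec (Needed u v)
  Needed? u v = ReliesOn? u v ⊎-dec ReliesOn? v u

  module _ (f-trd : IsTRDF G f) where
    open IsTRDF f-trd

    IsTRDF-deleteEdge : ∀ {u v} → ¬ Needed u v → IsTRDF (deleteEdge G u v) f
    IsTRDF-deleteEdge ¬needed = record
      { range = range
      ; roman = λ w fw≡0 → ∃neighbour-deleteEdge G (λ y → f y ≟ℕ 2)
          (λ { refl unique → ¬needed (inj₁ (inj₁ (fw≡0 , unique))) })
          (λ { refl unique → ¬needed (inj₂ (inj₁ (fw≡0 , unique))) })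
          (roman w fw≡0)
      ; total = λ w fw>0 → ∃neighbour-deleteEdge G (λ y → 0 <? f y)
          (λ { refl unique → ¬needed (inj₁ (inj₂ (fw>0 , unique))) })
          (λ { refl unique → ¬needed (inj₂ (inj₂ (fw>0 , unique))) })
          (total w fw>0)
      }

    ReliesOn⇒Positive : ∀ {u v} → ReliesOn u v → Positive v
    ReliesOn⇒Positive {u} (inj₁ (fu≡0 , unique)) =
      let (y , uy , fy≡2) = roman u fu≡0
      in subst Positive (unique y uy fy≡2) (subst (0 <_) (≡-sym fy≡2) (s≤s z≤n))
    ReliesOn⇒Positive {u} (inj₂ (fu>0 , unique)) =
      let (y , uy , fy>0) = total u fu>0
      in subst Positive (unique y uy fy>0) fy>0

    Needed-twice⇒Positive : ∀ {w p q} → p ≢ q → Needed w p → Needed w q → Positive w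
    Needed-twice⇒Positive _ (inj₂ p←w) _ = ReliesOn⇒Positive p←w
    Needed-twice⇒Positive _ _ (inj₂ q←w) = ReliesOn⇒Positive q←w
    Needed-twice⇒Positive _ (inj₁ (inj₂ (fw>0 , _))) _ = fw>0
    Needed-twice⇒Positive _ _ (inj₁ (inj₂ (fw>0 , _))) = fw>0
    Needed-twice⇒Positive {w} p≢q (inj₁ (inj₁ (fw≡0 , uniqueₚ)))
                                  (inj₁ (inj₁ (_ , uniqueₖ))) =
      let (y , wy , fy≡2) = roman w fw≡0
      in ⊥-elim (p≢q (trans (≡-sym (uniqueₚ y wy fy≡2)) (uniqueₖ y wy fy≡2)))

    Positive⇒¬ReliesOn : ∀ {u v x} → Positive u → Adj G u x → Positive x → x ≢ v →
                         ¬ ReliesOn u v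
    Positive⇒¬ReliesOn fu>0 _ _ _ (inj₁ (fu≡0 , _)) = <-irrefl (≡-sym fu≡0) fu>0
    Positive⇒¬ReliesOn _ ux fx>0 x≢v (inj₂ (_ , unique)) = x≢v (unique _ ux fx>0)

    -- Inner walk vertices are positive, so the relying end of the middle
    -- edge q₂q₃ has a second positive neighbour (q₁ or q₄).
    ¬walk-of-Needed : (q : ℕ → Fin n) → (∀ i → Adj G (q i) (q (suc i))) →
                      (∀ i → q i ≢ q (2 + i)) → ¬ (∀ i → Needed (q i) (q (suc i)))
    ¬walk-of-Needed q step distinct needed = middle-edge (needed 2)
      where
      positive : ∀ i → Positive (q (suc i))
      positive i = Needed-twice⇒Positive (distinct i) (swap (needed i)) (needed (suc i))
      middle-edge : ¬ Needed (q 2) (q 3)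
      middle-edge (inj₁ q₂←q₃) =
        Positive⇒¬ReliesOn (positive 1) (Adj-sym G (step 1)) (positive 0)
                           (distinct 1) q₂←q₃
      middle-edge (inj₂ q₃←q₂) =
        Positive⇒¬ReliesOn (positive 2) (step 3) (positive 3)
                           (distinct 2 ∘ ≡-sym) q₃←q₂

¬¬-γtR : ∀ {n} {G : Graph n} {f} → IsTRDF G f → ¬ ¬ (∃[ k ] IsγtR G k)
¬¬-γtR {G = G} {f} f-trd ¬γ =
  ¬¬-least (λ k → ∃[ g ] (IsTRDF G g × weight g ≡ k)) (weight f) (f , f-trd , refl)
    λ (k , attained , least) →
      ¬γ (k , attained , λ g g-trd → least (weight g) (g , g-trd , refl))

IsTRDF-const2 : ∀ {n} {G : Graph n} → NoIsolated G → IsTRDF G (λ _ → 2)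
IsTRDF-const2 noIsolated = record
  { range = λ _ → ≤-refl
  ; roman = λ _ ()
  ; total = λ v _ → let (u , vu) = noIsolated v in u , vu , s≤s z≤n
  }

module _ {n} {G : Graph n} (critical : ERCritical G) {k} (γ : IsγtR G k) where

  deleteEdge-raises-γ : ∀ {u v f} → Adj G u v → 2 ≤ deg G u → 2 ≤ deg G v →
                        IsTRDF (deleteEdge G u v) f → k < weight f
  deleteEdge-raises-γ {u} {v} {f} uv 2≤degu 2≤degv f-trd =
    decidable-stable (k <? weight f) λ k≮wf →
      ¬¬-γtR f-trd λ (k′ , γ′) → k≮wf (<-≤-trans (γ<γ′ γ′) (proj₂ γ′ f f-trd))
    where
    γ<γ′ : ∀ {k′} → IsγtR (deleteEdge G u v) k′ → k < k′
    γ<γ′ {k′} γ′ with proj₂ critical u v uv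
    ... | inj₁ degu≡1        = ⊥-elim (<-irrefl refl (subst (2 ≤_) degu≡1 2≤degu))
    ... | inj₂ (inj₁ degv≡1) = ⊥-elim (<-irrefl refl (subst (2 ≤_) degv≡1 2≤degv))
    ... | inj₂ (inj₂ raises) = raises k k′ γ γ′

  minimum-Needed : ∀ {f u v} → IsTRDF G f → weight f ≡ k → Adj G u v →
                   2 ≤ deg G u → 2 ≤ deg G v → Reliance.Needed G f u v
  minimum-Needed {f} {u} {v} f-trd wf≡k uv 2≤degu 2≤degv =
    decidable-stable (Reliance.Needed? G f u v) λ ¬needed →
      <-irrefl (≡-sym wf≡k) (deleteEdge-raises-γ uv 2≤degu 2≤degv
                              (Reliance.IsTRDF-deleteEdge G f f-trd ¬needed))

nextᵛ : ∀ {K} {i : Fin (suc K)} → View i → Fin (suc K)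
nextᵛ ‵fromℕ            = zero
nextᵛ (‵inj₁ {i = j} _) = suc j

next : ∀ {K} → Fin (suc K) → Fin (suc K)
next i = nextᵛ (view i)

toℕ-next : ∀ {K} (i : Fin (suc K)) →
           (i ≡ fromℕ K × next i ≡ zero) ⊎ toℕ (next i) ≡ suc (toℕ i)
toℕ-next i = toℕ-nextᵛ (view i)
  where
  toℕ-nextᵛ : ∀ {K} {i : Fin (suc K)} (v : View i) →
              (i ≡ fromℕ K × nextᵛ v ≡ zero) ⊎ toℕ (nextᵛ v) ≡ suc (toℕ i)
  toℕ-nextᵛ ‵fromℕ            = inj₁ (refl , refl)
  toℕ-nextᵛ (‵inj₁ {i = j} _) = inj₂ (cong suc (≡-sym (toℕ-inject₁ j)))

next∘next≢id : ∀ {m} (i : Fin (3 + m)) → next (next i) ≢ i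
next∘next≢id {m} i nni≡i with toℕ-next i | toℕ-next (next i)
... | inj₁ (refl , ni≡0) | _ =
  contradiction (subst (λ j → next j ≡ fromℕ (2 + m)) ni≡0 nni≡i) λ ()
... | inj₂ ni≡1+i | inj₁ (ni≡last , nni≡0) = contradiction (begin
  suc (suc m)           ≡⟨ toℕ-fromℕ (2 + m) ⟨
  toℕ (fromℕ (2 + m))  ≡⟨ cong toℕ ni≡last ⟨
  toℕ (next i)          ≡⟨ ni≡1+i ⟩
  suc (toℕ i)           ≡⟨ cong (suc ∘ toℕ) (trans (≡-sym nni≡i) nni≡0) ⟩
  1                     ∎) λ ()
  where open ≡-Reasoning
... | inj₂ ni≡1+i | inj₂ nni≡1+ni = m≢1+n+m (toℕ i) (begin
  toℕ i                 ≡⟨ cong toℕ nni≡i ⟨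
  toℕ (next (next i))   ≡⟨ nni≡1+ni ⟩
  suc (toℕ (next i))    ≡⟨ cong suc ni≡1+i ⟩
  suc (suc (toℕ i))     ∎)
  where open ≡-Reasoning

HasCycle⇒non-backtracking-walk : ∀ {n} {G : Graph n} → HasCycle G →
  ∃[ q ] ((∀ i → Adj G (q i) (q (suc i))) × (∀ i → q i ≢ q (2 + i)))
HasCycle⇒non-backtracking-walk {G = G} (m , c , c-inj , path , close) =
  c ∘ position , Adj-next ∘ position ,
  λ i → next∘next≢id (position i) ∘ ≡-sym ∘ c-inj
  where
  position : ℕ → Fin (3 + m)
  position zero    = zero
  position (suc i) = next (position i)

  Adj-nextᵛ : ∀ {j} (v : View j) → Adj G (c j) (c (nextᵛ v))
  Adj-nextᵛ ‵fromℕ            = close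
  Adj-nextᵛ (‵inj₁ {i = i} _) = path i

  Adj-next : ∀ j → Adj G (c j) (c (next j))
  Adj-next j = Adj-nextᵛ (view j)

ERCritical⇒¬HasCycle : ∀ {n} {G : Graph n} → ERCritical G → ¬ HasCycle G
ERCritical⇒¬HasCycle {G = G} critical cycle
  with HasCycle⇒non-backtracking-walk {G = G} cycle
... | q , step , distinct =
  ¬¬-γtR {G = G} (IsTRDF-const2 (proj₁ critical)) λ (k , γ) →
    let (f , f-trd , wf≡k) = proj₁ γ in
    Reliance.¬walk-of-Needed G f f-trd (q ∘ suc) (step ∘ suc) (distinct ∘ suc) λ i →
      minimum-Needed {G = G} critical γ f-trd wf≡k (step (suc i))
                     (2≤deg-inner i) (2≤deg-inner (suc i))
  where
  2≤deg-inner : ∀ i → 2 ≤ deg G (q (suc i))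
  2≤deg-inner i = 2≤deg G (Adj-sym G (step i)) (step (suc i)) (distinct i)

proposition7p8 : ∀ (n : ℕ) (G : Graph n) → Connected G → ERCritical G → IsTree G
proposition7p8 n G connected critical = connected , ERCritical⇒¬HasCycle critical
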